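{- Let $k$ be an odd positive integer and let $m$ be a positive integer. Then: (1) The integers whose prime decomposition has the form $p_1^{2^{m+1}k-1}$ ($p_1$ prime) are $2^mk$-$T_0T^\ast$-perfect numbers. (2) If $k>1$ and there exist integers $d_1,\dots,d_{m+2}$, each greater than $1$, with $d_1\cdots d_{m+2}=k$ and $d_i\equiv 1\pmod{2^{m+1}}$ for all $i\in\{1,\dots,m+2\}$, then the integers whose prime decomposition has the form $p_1^{(d_1-1)/2^{m+1}}\cdots p_{m+2}^{(d_{m+2}-1)/2^{m+1}}$ (distinct primes $p_i$) are $2^mk$-$T_0T^\ast$-perfect numbers. (3) Any integer $n>1$ whose prime decomposition is neither of the form $p_1^{2^{m+1}k-1}$ nor of the form $p_1^{(d_1-1)/2^{m+1}}\cdots p_{m+2}^{(d_{m+2}-1)/2^{m+1}}$ for some integers $d_1,\dots,d_{m+2}$ as in (2), is not a $2^mk$-$T_0T^\ast$-perfect number.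
   Context: $T(M)$ denotes the product of all positive divisors of $M$. A divisor $d$ of $M$ is unitary if $\gcd(d,M/d)=1$, and $T^\ast(M)$ denotes the product of all unitary divisors of $M$. For an integer $K\ge 2$, an integer $n>1$ is called $K$-$T_0T^\ast$-perfect if $T(T^\ast(n))=n^K$. -}

module Defs where

open import Data.Nat using (ℕ; zero; suc; _+_; _*_; _∸_; _^_; _<_; NonZero)
open import Data.Nat.Properties using (_≟_; m^n≢0)
open import Data.Nat.Divisibility using (_∣_; _∣?_)
open import Data.Nat.DivMod using (_/_; _%_)
open import Data.Nat.GCD using (gcd)
open import Data.Nat.Primality using (Prime)
open import Data.Fin using (Fin)
open import Data.List using (List; upTo; filter; map)
open import Data.Nat.ListAction using (product)
open import Data.Product using (_×_; Σ; ∃; _,_)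
open import Relation.Nullary using (¬_)
open import Relation.Nullary.Decidable using (_×-dec_)
open import Relation.Binary.PropositionalEquality using (_≡_)
open import Function.Definitions using (Injective)

prodFin : ∀ {n} → (Fin n → ℕ) → ℕ
prodFin {zero}  f = 1
prodFin {suc n} f = f Fin.zero * prodFin (λ i → f (Fin.suc i))

divisors : ℕ → List ℕ
divisors M = map suc (filter (λ j → suc j ∣? M) (upTo M))

unitaryDivisors : ℕ → List ℕ
unitaryDivisors M =
  map suc (filter (λ j → (suc j ∣? M) ×-dec (gcd (suc j) (M / suc j) ≟ 1)) (upTo M))

T : ℕ → ℕ
T M = product (divisors M)

T* : ℕ → ℕ
T* M = product (unitaryDivisors M)

IsKT0TStarPerfect : ℕ → ℕ → Set
IsKT0TStarPerfect K n = 1 < n × T (T* n) ≡ n ^ K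

pow2 : ℕ → ℕ
pow2 m = 2 ^ suc m

pow2-nonZero : ∀ m → NonZero (pow2 m)
pow2-nonZero m = m^n≢0 2 (suc m)

modP : ℕ → ℕ → ℕ
modP m x = _%_ x (pow2 m) {{pow2-nonZero m}}

divP : ℕ → ℕ → ℕ
divP m x = _/_ x (pow2 m) {{pow2-nonZero m}}

AdmissibleD : (m k : ℕ) → (Fin (suc (suc m)) → ℕ) → Set
AdmissibleD m k d =
  1 < k × (∀ i → 1 < d i) × prodFin d ≡ k × (∀ i → modP m (d i) ≡ modP m 1)

FormOne : (m k n : ℕ) → Set
FormOne m k n = Σ ℕ λ p → Prime p × n ≡ p ^ (pow2 m * k ∸ 1)

ProductForm : (m : ℕ) → (d p : Fin (suc (suc m)) → ℕ) → ℕ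
ProductForm m d p = prodFin (λ i → p i ^ (divP m (d i ∸ 1)))

DistinctPrimes : ∀ {r} → (Fin r → ℕ) → Set
DistinctPrimes p = (∀ i → Prime (p i)) × Injective _≡_ _≡_ p

FormTwo : (m k n : ℕ) → Set
FormTwo m k n = Σ (Fin (suc (suc m)) → ℕ) λ d → AdmissibleD m k d ×
  Σ (Fin (suc (suc m)) → ℕ) λ p → DistinctPrimes p × n ≡ ProductForm m d p

-- Pairing each divisor d of M with M / d gives T(M)² = M^τ(M), and pairing unitary divisors
-- likewise gives T*(M)² = M^(2^s) when M has s distinct prime factors. Hence for
-- n = p₁^a₁ ⋯ p_s^a_s with s ≥ 1 we get T*(n) = n^(2^(s-1)), and since τ(n^c) = ∏ (1 + c aᵢ),
-- n is K-T₀T*-perfect iff 2^(s-1) ∏ (1 + 2^(s-1) aᵢ) = 2K. For 2K = 2^(m+1) k with k odd: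
-- if s = 1 this says a₁ = 2^(m+1) k - 1; if s ≥ 2 the product is odd, which forces s - 1 = m + 1
-- and ∏ (1 + 2^(m+1) aᵢ) = k, i.e. dᵢ = 1 + 2^(m+1) aᵢ is an admissible family.
module Submission where

open import Defs
open import Data.Nat
open import Data.Nat.Properties
open import Data.Nat.Divisibility
open import Data.Nat.DivMod
open import Data.Nat.GCD using (gcd)
open import Data.Nat.Coprimality as Coprime using (Coprime)
open import Data.Nat.Primality
open import Data.Nat.Induction using (<-rec)
open import Data.Nat.ListAction using (product)
open import Data.Nat.Primality.Factorisation using (factorise)
open import Data.Nat.ListAction.Properties using (product-↭)
open import Data.List using (List; []; _∷_; map; upTo; length; _++_)
open import Data.List.Properties using (length-map; length-++)
open import Data.List.Membership.Propositional using (_∈_)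
open import Data.List.Membership.Propositional.Properties
open import Data.List.Membership.Propositional.Properties.WithK using (unique∧set⇒bag)
open import Data.List.Relation.Unary.Any using (here; there)
import Data.List.Relation.Unary.All as All
import Data.List.Relation.Unary.All.Properties as All
open import Data.List.Relation.Unary.AllPairs using ([]; _∷_)
open import Data.List.Relation.Unary.Unique.Propositional using (Unique)
import Data.List.Relation.Unary.Unique.Propositional.Properties as Unique
open import Data.List.Relation.Binary.BagAndSetEquality using (∼bag⇒↭)
open import Data.List.Relation.Binary.Disjoint.Propositional using (Disjoint)
open import Data.List.Relation.Binary.Permutation.Propositional using (_↭_)
open import Data.List.Relation.Binary.Permutation.Propositional.Properties using (↭-length)
open import Data.Product using (Σ; ∃-syntax; _×_; _,_; proj₁; proj₂)
open import Data.Sum using (_⊎_; inj₁; inj₂; [_,_]′)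
open import Data.Unit using (⊤; tt)
open import Relation.Nullary using (¬_; yes; no; contradiction)
open import Relation.Nullary.Decidable using (_×-dec_)
open import Relation.Binary.PropositionalEquality
open import Data.Fin using (Fin; zero; suc)
import Data.Fin.Properties as Fin
open import Data.Vec.Functional using (head; tail) renaming (_∷_ to _∷ᶠ_)
open import Function using (_∘_)
open import Function.Definitions using (Injective)
open import Function.Bundles using (_⇔_; mk⇔; Equivalence)
open import Relation.Binary.Definitions using (tri<; tri≈; tri>)
open import Algebra.Properties.CommutativeSemigroup *-commutativeSemigroup using (x∙yz≈y∙xz)

unique-same-elements⇒↭ : ∀ {A : Set} {xs ys : List A} → Unique xs → Unique ys →
  (∀ {x} → x ∈ xs → x ∈ ys) → (∀ {x} → x ∈ ys → x ∈ xs) → xs ↭ ys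
unique-same-elements⇒↭ uxs uys to from = ∼bag⇒↭ (unique∧set⇒bag uxs uys (mk⇔ to from))

unique-map⁺-injectiveOn : ∀ {A B : Set} (f : A → B) {xs} → Unique xs →
  (∀ {x y} → x ∈ xs → y ∈ xs → f x ≡ f y → x ≡ y) → Unique (map f xs)
unique-map⁺-injectiveOn f {[]} [] inj = []
unique-map⁺-injectiveOn f {x ∷ xs} (x∉xs ∷ uxs) inj =
  All.map⁺ (All.tabulate (λ y∈ fx≡fy → All.lookup x∉xs y∈ (inj (here refl) (there y∈) fx≡fy)))
  ∷ unique-map⁺-injectiveOn f uxs (λ x∈ y∈ → inj (there x∈) (there y∈))

length-disjoint-∪-map : ∀ {A B : Set} {xs ys : List B} {zs : List A} (f : A → B) →
  Unique xs → Unique ys → Unique zs → (∀ {x y} → f x ≡ f y → x ≡ y) →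
  Disjoint ys (map f zs) →
  (∀ {x} → x ∈ xs → x ∈ ys ⊎ x ∈ map f zs) →
  (∀ {y} → y ∈ ys → y ∈ xs) → (∀ {z} → z ∈ zs → f z ∈ xs) →
  length xs ≡ length ys + length zs
length-disjoint-∪-map {xs = xs} {ys} {zs} f uxs uys uzs f-inj disjoint split ys⊆xs fzs⊆xs = begin
  length xs                    ≡⟨ ↭-length xs↭ ⟩
  length (ys ++ map f zs)      ≡⟨ length-++ ys ⟩
  length ys + length (map f zs) ≡⟨ cong (length ys +_) (length-map f zs) ⟩
  length ys + length zs        ∎
  where
  open ≡-Reasoning
  from : ∀ {x} → x ∈ ys ++ map f zs → x ∈ xs
  from x∈ with ∈-++⁻ ys x∈
  ... | inj₁ x∈ys = ys⊆xs x∈ys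
  ... | inj₂ x∈fzs with ∈-map⁻ f x∈fzs
  ...   | z , z∈zs , refl = fzs⊆xs z∈zs
  xs↭ : xs ↭ ys ++ map f zs
  xs↭ = unique-same-elements⇒↭ uxs (Unique.++⁺ uys (Unique.map⁺ f-inj uzs) disjoint)
          (λ x∈ → [ ∈-++⁺ˡ , ∈-++⁺ʳ ys ]′ (split x∈)) from

nonZero-factorˡ : ∀ {d c M} .{{_ : NonZero M}} → d * c ≡ M → NonZero d
nonZero-factorˡ {zero} {c} {M} eq = contradiction (sym eq) (≢-nonZero⁻¹ M)
nonZero-factorˡ {suc d} eq = _

nonZero-factorʳ : ∀ {d c M} .{{_ : NonZero M}} → d * c ≡ M → NonZero c
nonZero-factorʳ {d} {c} eq = nonZero-factorˡ {c} {d} (trans (*-comm c d) eq)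

-- M / d, with a junk value at d = 0 so that no NonZero instance is needed.
cofactor : ℕ → ℕ → ℕ
cofactor M zero    = 0
cofactor M (suc d) = M / suc d

cofactor-≡ : ∀ {M} d {c} .{{_ : NonZero M}} → d * c ≡ M → cofactor M d ≡ c
cofactor-≡ {M} zero    eq = contradiction (sym eq) (≢-nonZero⁻¹ M)
cofactor-≡ {M} (suc d) {c} eq = begin
  M / suc d         ≡⟨ cong (_/ suc d) (trans (sym eq) (*-comm (suc d) c)) ⟩
  c * suc d / suc d ≡⟨ m*n/n≡m c (suc d) ⟩
  c                 ∎
  where open ≡-Reasoning

product*product-map≡^length : ∀ M (g : ℕ → ℕ) xs → (∀ {x} → x ∈ xs → x * g x ≡ M) →
  product xs * product (map g xs) ≡ M ^ length xs
product*product-map≡^length M g []       pairs = refl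
product*product-map≡^length M g (x ∷ xs) pairs = begin
  (x * product xs) * (g x * product (map g xs)) ≡⟨ [m*n]*[o*p]≡[m*o]*[n*p] x _ _ _ ⟩
  (x * g x) * (product xs * product (map g xs)) ≡⟨ cong₂ _*_ (pairs (here refl))
                                                    (product*product-map≡^length M g xs (pairs ∘ there)) ⟩
  M * M ^ length xs                             ∎
  where open ≡-Reasoning

-- Since d ↦ M / d permutes L, product L = product (map (M /_) L).
product²≡^length : ∀ M .{{_ : NonZero M}} (S : ℕ → ℕ → Set) → (∀ {d c} → S d c → S c d) →
  (L : List ℕ) → Unique L →
  (∀ {d} → d ∈ L → ∃[ c ] d * c ≡ M × S d c) →
  (∀ {d c} → d * c ≡ M → S d c → d ∈ L) →
  product L * product L ≡ M ^ length L
product²≡^length M S S-sym L uL ∈L⁻ ∈L⁺ =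
  trans (cong (product L *_) (product-↭ L↭gL)) (product*product-map≡^length M g L d*gd≡M)
  where
  g = cofactor M
  d*gd≡M : ∀ {d} → d ∈ L → d * g d ≡ M
  d*gd≡M {d} d∈ with ∈L⁻ d∈
  ... | c , d*c≡M , _ = trans (cong (d *_) (cofactor-≡ d d*c≡M)) d*c≡M
  g-injectiveOn : ∀ {x y} → x ∈ L → y ∈ L → g x ≡ g y → x ≡ y
  g-injectiveOn {x} {y} x∈ y∈ gx≡gy with ∈L⁻ x∈ | ∈L⁻ y∈
  ... | c , x*c≡M , _ | c' , y*c'≡M , _ = *-cancelʳ-≡ x y c {{nonZero-c}} (begin
    x * c  ≡⟨ x*c≡M ⟩
    M      ≡⟨ sym y*c'≡M ⟩
    y * c' ≡⟨ cong (y *_) (trans (sym (cofactor-≡ y y*c'≡M)) (trans (sym gx≡gy) (cofactor-≡ x x*c≡M))) ⟩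
    y * c  ∎)
    where
    open ≡-Reasoning
    nonZero-c : NonZero c
    nonZero-c = nonZero-factorʳ {x} x*c≡M
  L↭gL : L ↭ map g L
  L↭gL = unique-same-elements⇒↭ uL (unique-map⁺-injectiveOn g uL g-injectiveOn) to from
    where
    to : ∀ {d} → d ∈ L → d ∈ map g L
    to {d} d∈ with ∈L⁻ d∈
    ... | c , d*c≡M , s = subst (_∈ map g L) (cofactor-≡ c c*d≡M) (∈-map⁺ g (∈L⁺ c*d≡M (S-sym s)))
      where c*d≡M = trans (*-comm c d) d*c≡M
    from : ∀ {x} → x ∈ map g L → x ∈ L
    from x∈ with ∈-map⁻ g x∈
    ... | d , d∈ , refl with ∈L⁻ d∈
    ... | c , d*c≡M , s = ∈L⁺ (trans (*-comm (g d) d) (d*gd≡M d∈))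
                             (subst (λ z → S z d) (sym (cofactor-≡ d d*c≡M)) (S-sym s))

τ : ℕ → ℕ
τ M = length (divisors M)

τ* : ℕ → ℕ
τ* M = length (unitaryDivisors M)

UnitaryDivisor : ℕ → ℕ → Set
UnitaryDivisor M d = ∃[ c ] d * c ≡ M × Coprime d c

divisors-unique : ∀ M → Unique (divisors M)
divisors-unique M = Unique.map⁺ suc-injective (Unique.filter⁺ _ (Unique.upTo⁺ M))

unitaryDivisors-unique : ∀ M → Unique (unitaryDivisors M)
unitaryDivisors-unique M = Unique.map⁺ suc-injective (Unique.filter⁺ _ (Unique.upTo⁺ M))

∈-divisors⁺ : ∀ {M d} .{{_ : NonZero M}} → d ∣ M → d ∈ divisors M
∈-divisors⁺ {M} {zero}  0∣M = contradiction (0∣⇒≡0 0∣M) (≢-nonZero⁻¹ M)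
∈-divisors⁺ {M} {suc j} d∣M =
  ∈-map⁺ suc (∈-filter⁺ (λ j → suc j ∣? M) (∈-upTo⁺ (∣⇒≤ d∣M)) d∣M)

∈-divisors⁻ : ∀ {M d} → d ∈ divisors M → d ∣ M
∈-divisors⁻ {M} d∈ with ∈-map⁻ suc d∈
... | j , j∈ , refl = proj₂ (∈-filter⁻ (λ j → suc j ∣? M) {xs = upTo M} j∈)

∈-unitaryDivisors⁺ : ∀ {M d} .{{_ : NonZero M}} → UnitaryDivisor M d → d ∈ unitaryDivisors M
∈-unitaryDivisors⁺ {M} {zero}  (c , eq , _) = contradiction (sym eq) (≢-nonZero⁻¹ M)
∈-unitaryDivisors⁺ {M} {suc j} (c , eq , coprime) =
  ∈-map⁺ suc (∈-filter⁺ (λ j → (suc j ∣? M) ×-dec (gcd (suc j) (M / suc j) ≟ 1))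
    (∈-upTo⁺ (∣⇒≤ d∣M)) (d∣M , trans (cong (gcd (suc j)) (cofactor-≡ (suc j) eq)) (Coprime.coprime⇒gcd≡1 coprime)))
  where d∣M = subst (suc j ∣_) eq (m∣m*n c)

∈-unitaryDivisors⁻ : ∀ {M d} → d ∈ unitaryDivisors M → UnitaryDivisor M d
∈-unitaryDivisors⁻ {M} d∈ with ∈-map⁻ suc d∈
... | j , j∈ , refl with proj₂ (∈-filter⁻ (λ j → (suc j ∣? M) ×-dec (gcd (suc j) (M / suc j) ≟ 1)) {xs = upTo M} j∈)
... | d∣M , gcd≡1 = M / suc j , m*[n/m]≡n d∣M , Coprime.gcd≡1⇒coprime gcd≡1

T²≡^τ : ∀ M .{{_ : NonZero M}} → T M * T M ≡ M ^ τ M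
T²≡^τ M = product²≡^length M (λ _ _ → ⊤) (λ _ → tt) (divisors M) (divisors-unique M)
  (λ d∈ → let d∣M = ∈-divisors⁻ d∈ in quotient d∣M , sym (m∣n⇒n≡m*quotient d∣M) , tt)
  (λ {d} {c} d*c≡M _ → ∈-divisors⁺ (subst (d ∣_) d*c≡M (m∣m*n c)))

T*²≡^τ* : ∀ M .{{_ : NonZero M}} → T* M * T* M ≡ M ^ τ* M
T*²≡^τ* M = product²≡^length M Coprime Coprime.sym (unitaryDivisors M) (unitaryDivisors-unique M)
  ∈-unitaryDivisors⁻ (λ d*c≡M coprime → ∈-unitaryDivisors⁺ (_ , d*c≡M , coprime))

coprime-∣ : ∀ {a b a' b'} → Coprime a b → a' ∣ a → b' ∣ b → Coprime a' b'
coprime-∣ coprime a'∣a b'∣b (g∣a' , g∣b') = coprime (∣-trans g∣a' a'∣a , ∣-trans g∣b' b'∣b)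

coprime-*ʳ : ∀ {a b c} → Coprime a b → Coprime a c → Coprime a (b * c)
coprime-*ʳ a⊥b a⊥c (g∣a , g∣bc) = a⊥c (g∣a , Coprime.coprime-divisor (coprime-∣ a⊥b g∣a ∣-refl) g∣bc)

prime≢1 : ∀ {p} → Prime p → p ≢ 1
prime≢1 p-prime refl = ¬prime[1] p-prime

prime∤⇒coprime : ∀ {p d} → Prime p → ¬ p ∣ d → Coprime p d
prime∤⇒coprime p-prime p∤d (g∣p , g∣d) with prime⇒irreducible p-prime g∣p
... | inj₁ g≡1 = g≡1
... | inj₂ refl = contradiction g∣d p∤d

prime∤⇒coprime-^ : ∀ {p d} → Prime p → ¬ p ∣ d → ∀ a → Coprime (p ^ a) d
prime∤⇒coprime-^ p-prime p∤d zero    (g∣1 , _) = ∣1⇒≡1 g∣1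
prime∤⇒coprime-^ p-prime p∤d (suc a) =
  Coprime.sym (coprime-*ʳ (Coprime.sym (prime∤⇒coprime p-prime p∤d))
                          (Coprime.sym (prime∤⇒coprime-^ p-prime p∤d a)))

prime∣^⇒∣ : ∀ {p q} → Prime p → ∀ a → p ∣ q ^ a → p ∣ q
prime∣^⇒∣ p-prime zero    p∣1 = contradiction (∣1⇒≡1 p∣1) (prime≢1 p-prime)
prime∣^⇒∣ {q = q} p-prime (suc a) p∣q^[1+a] with euclidsLemma q (q ^ a) p-prime p∣q^[1+a]
... | inj₁ p∣q   = p∣q
... | inj₂ p∣q^a = prime∣^⇒∣ p-prime a p∣q^a

p∣p^a : ∀ p {a} → 0 < a → p ∣ p ^ a
p∣p^a p {suc a} _ = m∣m*n (p ^ a)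

prime>1 : ∀ {p} → Prime p → 1 < p
prime>1 {p} p-prime = nonTrivial⇒n>1 p {{prime⇒nonTrivial p-prime}}

prime∣prime⇒≡ : ∀ {q p} → Prime q → Prime p → q ∣ p → q ≡ p
prime∣prime⇒≡ q-prime p-prime q∣p with prime⇒irreducible p-prime q∣p
... | inj₁ q≡1 = contradiction q≡1 (prime≢1 q-prime)
... | inj₂ q≡p = q≡p

module _ {p r : ℕ} (p-prime : Prime p) (p∤r : ¬ p ∣ r) .{{r≢0 : NonZero r}} where
  private
    instance
      p≢0 : NonZero p
      p≢0 = prime⇒nonZero p-prime

    p^a*r≢0 : ∀ a → NonZero (p ^ a * r)
    p^a*r≢0 a = m*n≢0 (p ^ a) r {{m^n≢0 p a}}

  ∣p^[1+e]*r⇒∣r⊎p* : ∀ e {d} → d ∣ p ^ suc e * r → d ∣ r ⊎ ∃[ d' ] d ≡ p * d' × d' ∣ p ^ e * r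
  ∣p^[1+e]*r⇒∣r⊎p* e {d} d∣ with p ∣? d
  ... | yes (divides q refl) =
    inj₂ (q , *-comm q p , *-cancelˡ-∣ p (subst₂ _∣_ (*-comm q p) (*-assoc p (p ^ e) r) d∣))
  ... | no p∤d = inj₁ (Coprime.coprime-divisor (Coprime.sym (prime∤⇒coprime-^ p-prime p∤d (suc e))) d∣)

  τ[p^[1+e]*r] : ∀ e → τ (p ^ suc e * r) ≡ τ r + τ (p ^ e * r)
  τ[p^[1+e]*r] e = length-disjoint-∪-map (p *_)
    (divisors-unique (p ^ suc e * r)) (divisors-unique r) (divisors-unique (p ^ e * r)) (λ {x} {y} → *-cancelˡ-≡ x y p)
    disjoint split
    (λ d∈ → ∈-divisors⁺ {{p^a*r≢0 (suc e)}} (∣n⇒∣m*n (p ^ suc e) (∈-divisors⁻ d∈)))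
    (λ {d} d∈ → ∈-divisors⁺ {{p^a*r≢0 (suc e)}}
      (subst (p * d ∣_) (sym (*-assoc p (p ^ e) r)) (*-monoʳ-∣ p (∈-divisors⁻ d∈))))
    where
    disjoint : Disjoint (divisors r) (map (p *_) (divisors (p ^ e * r)))
    disjoint (d∈ , pd'∈) with ∈-map⁻ (p *_) pd'∈
    ... | d' , _ , refl = p∤r (∣-trans (m∣m*n d') (∈-divisors⁻ d∈))
    split : ∀ {d} → d ∈ divisors (p ^ suc e * r) → d ∈ divisors r ⊎ d ∈ map (p *_) (divisors (p ^ e * r))
    split d∈ with ∣p^[1+e]*r⇒∣r⊎p* e (∈-divisors⁻ d∈)
    ... | inj₁ d∣r = inj₁ (∈-divisors⁺ d∣r)
    ... | inj₂ (d' , refl , d'∣) = inj₂ (∈-map⁺ (p *_) (∈-divisors⁺ {{p^a*r≢0 e}} d'∣))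

  τ[p^a*r] : ∀ a → τ (p ^ a * r) ≡ suc a * τ r
  τ[p^a*r] zero    = trans (cong τ (*-identityˡ r)) (sym (+-identityʳ (τ r)))
  τ[p^a*r] (suc a) = trans (τ[p^[1+e]*r] a) (cong (τ r +_) (τ[p^a*r] a))

  unitary[p^a*r]⇒unitary[r]⊎p^a* : ∀ a {d} → UnitaryDivisor (p ^ a * r) d →
    UnitaryDivisor r d ⊎ ∃[ d' ] d ≡ p ^ a * d' × UnitaryDivisor r d'
  unitary[p^a*r]⇒unitary[r]⊎p^a* a {d} (c , d*c≡ , d⊥c) with p ∣? d
  ... | yes p∣d = inj₂ (q , d≡ , c , sym r≡ , coprime-∣ d⊥c (subst (q ∣_) (sym d≡) (n∣m*n (p ^ a))) ∣-refl)
    where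
    instance _ = p^a*r≢0 a
    instance _ = nonZero-factorʳ {d} d*c≡
    c∣r : c ∣ r
    c∣r = Coprime.coprime-divisor
      (Coprime.sym (prime∤⇒coprime-^ p-prime (λ p∣c → prime≢1 p-prime (d⊥c (p∣d , p∣c))) a))
      (subst (c ∣_) (trans (*-comm c d) d*c≡) (m∣m*n d))
    q = quotient c∣r
    r≡ : r ≡ q * c
    r≡ = m∣n⇒n≡quotient*m c∣r
    d≡ : d ≡ p ^ a * q
    d≡ = *-cancelʳ-≡ d (p ^ a * q) c (trans d*c≡ (trans (cong (p ^ a *_) r≡) (sym (*-assoc (p ^ a) q c))))
  ... | no p∤d = inj₁ (q , trans (*-comm d q) (sym r≡) , coprime-∣ d⊥c ∣-refl (subst (q ∣_) (sym c≡) (n∣m*n (p ^ a))))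
    where
    instance _ = p^a*r≢0 a
    instance _ = nonZero-factorˡ {d} d*c≡
    d∣r : d ∣ r
    d∣r = Coprime.coprime-divisor (Coprime.sym (prime∤⇒coprime-^ p-prime p∤d a)) (subst (d ∣_) d*c≡ (m∣m*n c))
    q = quotient d∣r
    r≡ : r ≡ q * d
    r≡ = m∣n⇒n≡quotient*m d∣r
    c≡ : c ≡ p ^ a * q
    c≡ = *-cancelˡ-≡ c (p ^ a * q) d (begin
      d * c           ≡⟨ d*c≡ ⟩
      p ^ a * r       ≡⟨ cong (p ^ a *_) (trans r≡ (*-comm q d)) ⟩
      p ^ a * (d * q) ≡⟨ x∙yz≈y∙xz (p ^ a) d q ⟩
      d * (p ^ a * q) ∎)
      where open ≡-Reasoning

  τ*[p^a*r] : ∀ a → 0 < a → τ* (p ^ a * r) ≡ τ* r + τ* r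
  τ*[p^a*r] a a>0 = length-disjoint-∪-map (p ^ a *_)
    (unitaryDivisors-unique (p ^ a * r)) (unitaryDivisors-unique r) (unitaryDivisors-unique r)
    (λ {x} {y} → *-cancelˡ-≡ x y (p ^ a) {{m^n≢0 p a}}) disjoint split
    (λ d∈ → ∈-unitaryDivisors⁺ {{p^a*r≢0 a}} (extendˡ (∈-unitaryDivisors⁻ d∈)))
    (λ d∈ → ∈-unitaryDivisors⁺ {{p^a*r≢0 a}} (extendʳ (∈-unitaryDivisors⁻ d∈)))
    where
    p^a⊥ : ∀ {x} → x ∣ r → Coprime (p ^ a) x
    p^a⊥ x∣r = prime∤⇒coprime-^ p-prime (λ p∣x → p∤r (∣-trans p∣x x∣r)) a
    extendˡ : ∀ {d} → UnitaryDivisor r d → UnitaryDivisor (p ^ a * r) d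
    extendˡ {d} (c , d*c≡r , d⊥c) =
      p ^ a * c , trans (x∙yz≈y∙xz d (p ^ a) c) (cong (p ^ a *_) d*c≡r) ,
      coprime-*ʳ (Coprime.sym (p^a⊥ (subst (d ∣_) d*c≡r (m∣m*n c)))) d⊥c
    extendʳ : ∀ {d} → UnitaryDivisor r d → UnitaryDivisor (p ^ a * r) (p ^ a * d)
    extendʳ {d} (c , d*c≡r , d⊥c) =
      c , trans (*-assoc (p ^ a) d c) (cong (p ^ a *_) d*c≡r) ,
      Coprime.sym (coprime-*ʳ (Coprime.sym (p^a⊥ (subst (c ∣_) (trans (*-comm c d) d*c≡r) (m∣m*n d))))
                              (Coprime.sym d⊥c))
    disjoint : Disjoint (unitaryDivisors r) (map (p ^ a *_) (unitaryDivisors r))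
    disjoint (d∈ , p^ad'∈) with ∈-map⁻ (p ^ a *_) p^ad'∈
    ... | d' , _ , refl with ∈-unitaryDivisors⁻ d∈
    ...   | c , d*c≡r , _ = p∤r (∣-trans (∣-trans (p∣p^a p a>0) (m∣m*n d')) (subst (_ ∣_) d*c≡r (m∣m*n c)))
    split : ∀ {d} → d ∈ unitaryDivisors (p ^ a * r) →
      d ∈ unitaryDivisors r ⊎ d ∈ map (p ^ a *_) (unitaryDivisors r)
    split d∈ with unitary[p^a*r]⇒unitary[r]⊎p^a* a (∈-unitaryDivisors⁻ d∈)
    ... | inj₁ unitary = inj₁ (∈-unitaryDivisors⁺ unitary)
    ... | inj₂ (d' , refl , unitary) = inj₂ (∈-map⁺ (p ^ a *_) (∈-unitaryDivisors⁺ unitary))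

[m*n]^o≡m^o*n^o : ∀ m n o → (m * n) ^ o ≡ m ^ o * n ^ o
[m*n]^o≡m^o*n^o m n zero    = refl
[m*n]^o≡m^o*n^o m n (suc o) =
  trans (cong (m * n *_) ([m*n]^o≡m^o*n^o m n o)) ([m*n]*[o*p]≡[m*o]*[n*p] m n (m ^ o) (n ^ o))

prodFin-cong : ∀ {r} {f g : Fin r → ℕ} → (∀ i → f i ≡ g i) → prodFin f ≡ prodFin g
prodFin-cong {zero}  f≗g = refl
prodFin-cong {suc r} f≗g = cong₂ _*_ (f≗g zero) (prodFin-cong (f≗g ∘ suc))

prodFin-^ : ∀ {r} (f : Fin r → ℕ) c → prodFin f ^ c ≡ prodFin (λ i → f i ^ c)
prodFin-^ {zero}  f c = ^-zeroˡ c
prodFin-^ {suc r} f c =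
  trans ([m*n]^o≡m^o*n^o (f zero) _ c) (cong (f zero ^ c *_) (prodFin-^ (f ∘ suc) c))

prodFin-nonZero : ∀ {r} (f : Fin r → ℕ) → (∀ i → NonZero (f i)) → NonZero (prodFin f)
prodFin-nonZero {zero}  f f≢0 = _
prodFin-nonZero {suc r} f f≢0 = m*n≢0 (f zero) _ {{f≢0 zero}} {{prodFin-nonZero (f ∘ suc) (f≢0 ∘ suc)}}

∣prodFin : ∀ {r} (f : Fin r → ℕ) i → f i ∣ prodFin f
∣prodFin f zero    = m∣m*n _
∣prodFin f (suc i) = ∣n⇒∣m*n (f zero) (∣prodFin (f ∘ suc) i)

prime∣prodFin⇒∣ : ∀ {q r} → Prime q → (f : Fin r → ℕ) → q ∣ prodFin f → ∃[ i ] q ∣ f i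
prime∣prodFin⇒∣ {r = zero}  q-prime f q∣1 = contradiction (∣1⇒≡1 q∣1) (prime≢1 q-prime)
prime∣prodFin⇒∣ {r = suc r} q-prime f q∣ with euclidsLemma (f zero) (prodFin (f ∘ suc)) q-prime q∣
... | inj₁ q∣f0   = zero , q∣f0
... | inj₂ q∣rest with prime∣prodFin⇒∣ q-prime (f ∘ suc) q∣rest
...   | i , q∣fi = suc i , q∣fi

primePowerProduct : ∀ {r} → (Fin r → ℕ) → (Fin r → ℕ) → ℕ
primePowerProduct p e = prodFin (λ i → p i ^ e i)

module _ {r} {p e : Fin r → ℕ} where

  primePowerProduct-nonZero : (∀ i → Prime (p i)) → NonZero (primePowerProduct p e)
  primePowerProduct-nonZero primes = prodFin-nonZero _ (λ i → m^n≢0 (p i) (e i) {{prime⇒nonZero (primes i)}})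

  ∣primePowerProduct : (∀ i → 0 < e i) → ∀ i → p i ∣ primePowerProduct p e
  ∣primePowerProduct e>0 i = ∣-trans (p∣p^a (p i) (e>0 i)) (∣prodFin (λ i → p i ^ e i) i)

  primePowerProduct-^ : ∀ c → primePowerProduct p e ^ c ≡ primePowerProduct p (λ i → c * e i)
  primePowerProduct-^ c = trans (prodFin-^ (λ i → p i ^ e i) c)
    (prodFin-cong (λ i → trans (^-*-assoc (p i) (e i) c) (cong (p i ^_) (*-comm (e i) c))))

  distinctPrimes-∷ : ∀ {q} → Prime q → ¬ q ∣ primePowerProduct p e → (∀ i → 0 < e i) →
    DistinctPrimes p → DistinctPrimes (q ∷ᶠ p)
  distinctPrimes-∷ {q} q-prime q∤ e>0 (primes , injective) = primes′ , injective′
    where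
    primes′ : ∀ i → Prime ((q ∷ᶠ p) i)
    primes′ zero    = q-prime
    primes′ (suc i) = primes i
    q≢p : ∀ i → q ≢ p i
    q≢p i refl = q∤ (∣primePowerProduct e>0 i)
    injective′ : Injective _≡_ _≡_ (q ∷ᶠ p)
    injective′ {zero}  {zero}  _  = refl
    injective′ {zero}  {suc j} eq = contradiction eq (q≢p j)
    injective′ {suc i} {zero}  eq = contradiction (sym eq) (q≢p i)
    injective′ {suc i} {suc j} eq = cong suc (injective eq)

distinctPrimes-tail : ∀ {r} {p : Fin (suc r) → ℕ} → DistinctPrimes p → DistinctPrimes (tail p)
distinctPrimes-tail (primes , injective) = primes ∘ suc , Fin.suc-injective ∘ injective

module _ {r} {p e : Fin (suc r) → ℕ} where

  head∤primePowerProduct-tail : DistinctPrimes p → ¬ head p ∣ primePowerProduct (tail p) (tail e)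
  head∤primePowerProduct-tail (primes , injective) p₀∣ with prime∣prodFin⇒∣ (primes zero) (λ i → tail p i ^ tail e i) p₀∣
  ... | i , p₀∣pᵢ^eᵢ with injective (prime∣prime⇒≡ (primes zero) (primes (suc i))
                                       (prime∣^⇒∣ (primes zero) (e (suc i)) p₀∣pᵢ^eᵢ))
  ... | ()

  primePowerProduct>1 : (∀ i → Prime (p i)) → (∀ i → 0 < e i) → 1 < primePowerProduct p e
  primePowerProduct>1 primes e>0 = <-≤-trans (^-monoʳ-< (p zero) (prime>1 (primes zero)) (e>0 zero))
    (m≤m*n (p zero ^ e zero) _ {{primePowerProduct-nonZero {e = tail e} (primes ∘ suc)}})

τ-primePowerProduct : ∀ {r} (p e : Fin r → ℕ) → DistinctPrimes p →
  τ (primePowerProduct p e) ≡ prodFin (λ i → suc (e i))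
τ-primePowerProduct {zero}  p e _        = refl
τ-primePowerProduct {suc r} p e distinct@(primes , _) =
  trans (τ[p^a*r] (primes zero) (head∤primePowerProduct-tail {e = e} distinct)
                  {{primePowerProduct-nonZero {e = tail e} (primes ∘ suc)}} (e zero))
        (cong (suc (e zero) *_) (τ-primePowerProduct (tail p) (tail e) (distinctPrimes-tail distinct)))

τ*-primePowerProduct : ∀ {r} (p e : Fin r → ℕ) → DistinctPrimes p → (∀ i → 0 < e i) →
  τ* (primePowerProduct p e) ≡ 2 ^ r
τ*-primePowerProduct {zero}  p e _ _ = refl
τ*-primePowerProduct {suc r} p e distinct@(primes , _) e>0 = begin
  τ* (primePowerProduct p e)    ≡⟨ τ*[p^a*r] (primes zero) (head∤primePowerProduct-tail {e = e} distinct)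
                                     {{primePowerProduct-nonZero {e = tail e} (primes ∘ suc)}} (e zero) (e>0 zero) ⟩
  τ* rest + τ* rest             ≡⟨ cong₂ _+_ τ*-rest τ*-rest ⟩
  2 ^ r + 2 ^ r                 ≡⟨ cong (2 ^ r +_) (sym (+-identityʳ (2 ^ r))) ⟩
  2 ^ suc r                     ∎
  where
  open ≡-Reasoning
  rest = primePowerProduct (tail p) (tail e)
  τ*-rest : τ* rest ≡ 2 ^ r
  τ*-rest = τ*-primePowerProduct (tail p) (tail e) (distinctPrimes-tail distinct) (e>0 ∘ suc)

PrimePowerDecomposition : ℕ → ℕ → Set
PrimePowerDecomposition r n = Σ (Fin r → ℕ) λ p → Σ (Fin r → ℕ) λ e →
  DistinctPrimes p × (∀ i → 0 < e i) × n ≡ primePowerProduct p e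

prime-divisor : ∀ n → 1 < n → ∃[ p ] Prime p × p ∣ n
prime-divisor n@(suc _) n>1 with factorise n
... | record { factors = [] ; isFactorisation = n≡1 } = contradiction n≡1 (>⇒≢ n>1)
... | record { factors = q ∷ qs ; isFactorisation = n≡ ; factorsPrime = q-prime All.∷ _ } =
  q , q-prime , subst (q ∣_) (sym n≡) (m∣m*n _)

factorOut : ∀ {p} → Prime p → ∀ n .{{_ : NonZero n}} → ∃[ a ] ∃[ r ] n ≡ p ^ a * r × ¬ p ∣ r
factorOut {p} p-prime = <-rec P step
  where
  P : ℕ → Set
  P n = .{{_ : NonZero n}} → ∃[ a ] ∃[ r ] n ≡ p ^ a * r × ¬ p ∣ r
  step : ∀ n → (∀ {m} → m < n → P m) → P n
  step n rec with p ∣? n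
  ... | no p∤n = 0 , n , sym (*-identityˡ n) , p∤n
  ... | yes (divides q refl) with rec q<qp {{q≢0}}
    where
    q≢0 : NonZero q
    q≢0 = m*n≢0⇒m≢0 q
    q<qp : q < q * p
    q<qp = m<m*n q p {{q≢0}} (prime>1 p-prime)
  ...   | a , r , q≡ , p∤r = suc a , r , trans (cong (_* p) q≡) (trans (*-comm _ p) (sym (*-assoc p (p ^ a) r))) , p∤r

primePowerDecomposition : ∀ n .{{_ : NonZero n}} → ∃[ r ] PrimePowerDecomposition r n
primePowerDecomposition = <-rec P step
  where
  P : ℕ → Set
  P n = .{{_ : NonZero n}} → ∃[ r ] PrimePowerDecomposition r n
  step : ∀ n → (∀ {m} → m < n → P m) → P n
  step 1 _ = 0 , (λ ()) , (λ ()) , ((λ ()) , λ { {()} }) , (λ ()) , refl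
  step n@(suc (suc _)) rec with prime-divisor n (s≤s (s≤s z≤n))
  ... | q , q-prime , q∣n with factorOut q-prime n
  ...   | zero , m , n≡ , q∤m = contradiction (subst (q ∣_) (trans n≡ (*-identityˡ m)) q∣n) q∤m
  ...   | suc a , m , n≡ , q∤m with rec m<n {{m≢0}}
    where
    m≢0 : NonZero m
    m≢0 = nonZero-factorʳ {q ^ suc a} (sym n≡)
    m<n : m < n
    m<n = subst (m <_) (trans (*-comm m _) (sym n≡))
            (m<m*n m (q ^ suc a) {{m≢0}} (^-monoʳ-< q (prime>1 q-prime) {0} {suc a} (s≤s z≤n)))
  ...     | r , p , e , distinct , e>0 , m≡ =
    suc r , q ∷ᶠ p , suc a ∷ᶠ e ,
    distinctPrimes-∷ q-prime (subst (λ x → ¬ q ∣ x) m≡ q∤m) e>0 distinct ,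
    (λ { zero → s≤s z≤n ; (suc i) → e>0 i }) ,
    trans n≡ (cong (q ^ suc a *_) m≡)

m*m≡n*n⇒m≡n : ∀ {m n} → m * m ≡ n * n → m ≡ n
m*m≡n*n⇒m≡n {m} {n} eq with <-cmp m n
... | tri< m<n _ _ = contradiction eq (<⇒≢ (*-mono-< m<n m<n))
... | tri≈ _ m≡n _ = m≡n
... | tri> _ _ m>n = contradiction (sym eq) (<⇒≢ (*-mono-< m>n m>n))

^-injectiveʳ : ∀ {n a b} → 1 < n → n ^ a ≡ n ^ b → a ≡ b
^-injectiveʳ {n} {a} {b} n>1 eq with <-cmp a b
... | tri< a<b _ _ = contradiction eq (<⇒≢ (^-monoʳ-< n n>1 a<b))
... | tri≈ _ a≡b _ = a≡b
... | tri> _ _ a>b = contradiction (sym eq) (<⇒≢ (^-monoʳ-< n n>1 a>b))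

module _ {t} (p e : Fin (suc t) → ℕ) (distinct : DistinctPrimes p) (e>0 : ∀ i → 0 < e i) where
  private
    n = primePowerProduct p e
    c = 2 ^ t
    Q = prodFin (λ i → suc (c * e i))
    instance
      n≢0 : NonZero n
      n≢0 = primePowerProduct-nonZero {e = e} (proj₁ distinct)

  T*-primePowerProduct : T* n ≡ n ^ c
  T*-primePowerProduct = m*m≡n*n⇒m≡n (begin
    T* n * T* n   ≡⟨ T*²≡^τ* n ⟩
    n ^ τ* n      ≡⟨ cong (n ^_) (τ*-primePowerProduct p e distinct e>0) ⟩
    n ^ (c + (c + 0)) ≡⟨ cong (λ x → n ^ (c + x)) (+-identityʳ c) ⟩
    n ^ (c + c)   ≡⟨ ^-distribˡ-+-* n c c ⟩
    n ^ c * n ^ c ∎)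
    where open ≡-Reasoning

  -- T*(n) = n^(2^t) is again a product of the same prime powers, with exponents scaled by 2^t.
  T∘T*²-primePowerProduct : T (T* n) * T (T* n) ≡ n ^ (c * Q)
  T∘T*²-primePowerProduct = begin
    T (T* n) * T (T* n)                           ≡⟨ cong (λ x → T x * T x) T*-primePowerProduct ⟩
    T (n ^ c) * T (n ^ c)                         ≡⟨ T²≡^τ (n ^ c) {{m^n≢0 n c}} ⟩
    (n ^ c) ^ τ (n ^ c)                           ≡⟨ cong (λ x → (n ^ c) ^ τ x) (primePowerProduct-^ {p = p} {e} c) ⟩
    (n ^ c) ^ τ (primePowerProduct p (λ i → c * e i)) ≡⟨ cong ((n ^ c) ^_) (τ-primePowerProduct p (λ i → c * e i) distinct) ⟩
    (n ^ c) ^ Q                                   ≡⟨ ^-*-assoc n c Q ⟩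
    n ^ (c * Q)                                   ∎
    where open ≡-Reasoning

  T∘T*≡^⇔ : ∀ K → T (T* n) ≡ n ^ K ⇔ c * Q ≡ K + K
  T∘T*≡^⇔ K = mk⇔
    (λ T∘T*≡ → ^-injectiveʳ (primePowerProduct>1 {p = p} {e} (proj₁ distinct) e>0) (begin
      n ^ (c * Q)         ≡⟨ sym T∘T*²-primePowerProduct ⟩
      T (T* n) * T (T* n) ≡⟨ cong₂ _*_ T∘T*≡ T∘T*≡ ⟩
      n ^ K * n ^ K       ≡⟨ sym (^-distribˡ-+-* n K K) ⟩
      n ^ (K + K)         ∎))
    (λ cQ≡ → m*m≡n*n⇒m≡n (begin
      T (T* n) * T (T* n) ≡⟨ T∘T*²-primePowerProduct ⟩
      n ^ (c * Q)         ≡⟨ cong (n ^_) cQ≡ ⟩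
      n ^ (K + K)         ≡⟨ ^-distribˡ-+-* n K K ⟩
      n ^ K * n ^ K       ∎))
    where open ≡-Reasoning

¬2∣1+2^[1+a]*y : ∀ a y → ¬ 2 ∣ suc (2 ^ suc a * y)
¬2∣1+2^[1+a]*y a y (divides q eq) =
  even≢odd q (2 ^ a * y) (trans (*-comm 2 q) (trans (sym eq) (cong suc (*-assoc 2 (2 ^ a) y))))

¬2∣prodFin : ∀ {r} (f : Fin r → ℕ) → (∀ i → ¬ 2 ∣ f i) → ¬ 2 ∣ prodFin f
¬2∣prodFin f odd 2∣ with prime∣prodFin⇒∣ prime[2] f 2∣
... | i , 2∣fᵢ = odd i 2∣fᵢ

2^a*odd-injective : ∀ a b {x y} → 2 ^ a * x ≡ 2 ^ b * y → ¬ 2 ∣ x → ¬ 2 ∣ y → a ≡ b × x ≡ y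
2^a*odd-injective zero    zero    {x} {y} eq _ _ =
  refl , trans (sym (*-identityˡ x)) (trans eq (*-identityˡ y))
2^a*odd-injective zero    (suc b) {x} {y} eq x-odd _ =
  contradiction (subst (2 ∣_) (trans (sym eq) (*-identityˡ x)) (∣m⇒∣m*n y (m∣m*n (2 ^ b)))) x-odd
2^a*odd-injective (suc a) zero    {x} {y} eq _ y-odd =
  contradiction (subst (2 ∣_) (trans eq (*-identityˡ y)) (∣m⇒∣m*n x (m∣m*n (2 ^ a)))) y-odd
2^a*odd-injective (suc a) (suc b) {x} {y} eq x-odd y-odd
  with 2^a*odd-injective a b
         (*-cancelˡ-≡ _ _ 2 (trans (sym (*-assoc 2 (2 ^ a) x)) (trans eq (*-assoc 2 (2 ^ b) y)))) x-odd y-odd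
... | a≡b , x≡y = cong suc a≡b , x≡y

1*[[1+1*a]*1]≡1+a : ∀ a → 1 * (suc (1 * a) * 1) ≡ suc a
1*[[1+1*a]*1]≡1+a a = trans (*-identityˡ _) (trans (*-identityʳ _) (cong suc (*-identityˡ a)))

suc[n∸1]≡n : ∀ {n} → 0 < n → suc (n ∸ 1) ≡ n
suc[n∸1]≡n {suc n} _ = refl

2^m*k+2^m*k≡pow2*k : ∀ m k → 2 ^ m * k + 2 ^ m * k ≡ pow2 m * k
2^m*k+2^m*k≡pow2*k m k = trans (cong (2 ^ m * k +_) (sym (+-identityʳ _))) (sym (*-assoc 2 (2 ^ m) k))

module _ (m : ℕ) where
  private
    instance
      pow2≢0 : NonZero (pow2 m)
      pow2≢0 = pow2-nonZero m

  pow2>1 : 1 < pow2 m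
  pow2>1 = ^-monoʳ-< 2 (s≤s (s≤s z≤n)) {0} {suc m} z<s

  ≡1-mod-pow2⇒≡1+pow2*divP : ∀ x → modP m x ≡ modP m 1 → suc (pow2 m * divP m (x ∸ 1)) ≡ x
  ≡1-mod-pow2⇒≡1+pow2*divP x x≡1 = begin
    suc (pow2 m * divP m (x ∸ 1)) ≡⟨ cong (λ y → suc (pow2 m * y)) divP[x∸1]≡x/P ⟩
    suc (pow2 m * (x / pow2 m))   ≡⟨ cong suc (*-comm (pow2 m) _) ⟩
    1 + x / pow2 m * pow2 m       ≡⟨ sym x≡ ⟩
    x                             ∎
    where
    open ≡-Reasoning
    x≡ : x ≡ 1 + x / pow2 m * pow2 m
    x≡ = trans (m≡m%n+[m/n]*n x (pow2 m)) (cong (_+ x / pow2 m * pow2 m) (trans x≡1 (m<n⇒m%n≡m pow2>1)))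
    divP[x∸1]≡x/P : divP m (x ∸ 1) ≡ x / pow2 m
    divP[x∸1]≡x/P = trans (cong (λ y → (y ∸ 1) / pow2 m) x≡) (m*n/n≡m (x / pow2 m) (pow2 m))

  divP[x∸1]>0 : ∀ x → modP m x ≡ modP m 1 → 1 < x → 0 < divP m (x ∸ 1)
  divP[x∸1]>0 x x≡1 x>1 with divP m (x ∸ 1) in eq
  ... | zero  = contradiction (trans (sym (≡1-mod-pow2⇒≡1+pow2*divP x x≡1)) (cong (λ y → suc (pow2 m * y)) eq))
                             (λ x≡1+P*0 → >⇒≢ x>1 (trans x≡1+P*0 (cong suc (*-zeroʳ (pow2 m)))))
  ... | suc _ = z<s

  modP[1+pow2*e] : ∀ e → modP m (suc (pow2 m * e)) ≡ modP m 1
  modP[1+pow2*e] e = trans (cong (λ y → suc y % pow2 m) (*-comm (pow2 m) e)) ([m+kn]%n≡m%n 1 e (pow2 m))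

  divP[pow2*e] : ∀ e → divP m (pow2 m * e) ≡ e
  divP[pow2*e] e = trans (cong (_/ pow2 m) (*-comm (pow2 m) e)) (m*n/n≡m e (pow2 m))

formOne⇒perfect : ∀ m k → 0 < k → (p : ℕ) → Prime p →
  IsKT0TStarPerfect (2 ^ m * k) (p ^ (pow2 m * k ∸ 1))
formOne⇒perfect m k k>0 p p-prime = subst (IsKT0TStarPerfect K) (*-identityʳ (p ^ a)) perfect
  where
  K = 2 ^ m * k
  a = pow2 m * k ∸ 1
  1+a≡ : suc a ≡ pow2 m * k
  1+a≡ = suc[n∸1]≡n (*-mono-≤ (<-trans z<s (pow2>1 m)) k>0)
  a>0 : 0 < a
  a>0 = ≤-pred (subst (1 <_) (sym 1+a≡) (*-mono-≤ (pow2>1 m) k>0))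
  distinct : DistinctPrimes {1} (λ _ → p)
  distinct = (λ _ → p-prime) , λ { {zero} {zero} _ → refl }
  exponent-equation : 2 ^ 0 * prodFin {1} (λ _ → suc (2 ^ 0 * a)) ≡ K + K
  exponent-equation = begin
    1 * (suc (1 * a) * 1) ≡⟨ 1*[[1+1*a]*1]≡1+a a ⟩
    suc a                 ≡⟨ 1+a≡ ⟩
    pow2 m * k            ≡⟨ sym (2^m*k+2^m*k≡pow2*k m k) ⟩
    K + K                 ∎
    where open ≡-Reasoning
  perfect : IsKT0TStarPerfect K (primePowerProduct {1} (λ _ → p) (λ _ → a))
  perfect = primePowerProduct>1 {p = λ _ → p} {λ _ → a} (proj₁ distinct) (λ _ → a>0)
          , Equivalence.from (T∘T*≡^⇔ (λ _ → p) (λ _ → a) distinct (λ _ → a>0) K) exponent-equation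

formTwo⇒perfect : ∀ m k (d : Fin (suc (suc m)) → ℕ) → AdmissibleD m k d →
  (p : Fin (suc (suc m)) → ℕ) → DistinctPrimes p → IsKT0TStarPerfect (2 ^ m * k) (ProductForm m d p)
formTwo⇒perfect m k d (_ , d>1 , prod≡k , d≡1) p distinct =
  primePowerProduct>1 {p = p} {e} (proj₁ distinct) e>0 ,
  Equivalence.from (T∘T*≡^⇔ p e distinct e>0 (2 ^ m * k)) (begin
    pow2 m * prodFin (λ i → suc (pow2 m * e i)) ≡⟨ cong (pow2 m *_) (prodFin-cong (λ i →
                                                     ≡1-mod-pow2⇒≡1+pow2*divP m (d i) (d≡1 i))) ⟩
    pow2 m * prodFin d                          ≡⟨ cong (pow2 m *_) prod≡k ⟩
    pow2 m * k                                  ≡⟨ sym (2^m*k+2^m*k≡pow2*k m k) ⟩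
    2 ^ m * k + 2 ^ m * k                       ∎)
  where
  open ≡-Reasoning
  e : Fin (suc (suc m)) → ℕ
  e i = divP m (d i ∸ 1)
  e>0 : ∀ i → 0 < e i
  e>0 i = divP[x∸1]>0 m (d i) (d≡1 i) (d>1 i)

primePowerProduct-formTwo : ∀ {m k} (p e : Fin (suc (suc m)) → ℕ) → DistinctPrimes p → (∀ i → 0 < e i) →
  prodFin (λ i → suc (pow2 m * e i)) ≡ k → FormTwo m k (primePowerProduct p e)
primePowerProduct-formTwo {m} {k} p e distinct e>0 prod≡k =
  d , (k>1 , d>1 , prod≡k , modP[1+pow2*e] m ∘ e) , p , distinct ,
  prodFin-cong (λ i → cong (p i ^_) (sym (divP[pow2*e] m (e i))))
  where
  d : Fin (suc (suc m)) → ℕ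
  d i = suc (pow2 m * e i)
  d>1 : ∀ i → 1 < d i
  d>1 i = s≤s (*-mono-< (<-trans z<s (pow2>1 m)) (e>0 i))
  k>1 : 1 < k
  k>1 = subst (1 <_) prod≡k (<-≤-trans (d>1 zero)
          (m≤m*n (d zero) _ {{prodFin-nonZero (d ∘ suc) (λ i → >-nonZero (<-trans z<s (d>1 (suc i))))}}))

exponent-equation⇒formOne⊎formTwo : ∀ {m k t} → ¬ 2 ∣ k →
  (p e : Fin (suc t) → ℕ) → DistinctPrimes p → (∀ i → 0 < e i) →
  2 ^ t * prodFin (λ i → suc (2 ^ t * e i)) ≡ pow2 m * k →
  FormOne m k (primePowerProduct p e) ⊎ FormTwo m k (primePowerProduct p e)
exponent-equation⇒formOne⊎formTwo {m} {k} {zero} _ p e distinct _ eq =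
  inj₁ (p zero , proj₁ distinct zero , trans (*-identityʳ _) (cong (p zero ^_) e₀≡))
  where
  e₀≡ : e zero ≡ pow2 m * k ∸ 1
  e₀≡ = cong (_∸ 1) (trans (sym (1*[[1+1*a]*1]≡1+a (e zero))) eq)
exponent-equation⇒formOne⊎formTwo {m} {t = suc t} k-odd p e distinct e>0 eq
  with 2^a*odd-injective (suc t) (suc m) eq (¬2∣prodFin _ (λ i → ¬2∣1+2^[1+a]*y t (e i))) k-odd
... | refl , prod≡k = inj₂ (primePowerProduct-formTwo p e distinct e>0 prod≡k)

perfect⇒formOne⊎formTwo : ∀ m k → ¬ 2 ∣ k → ∀ n → IsKT0TStarPerfect (2 ^ m * k) n →
  FormOne m k n ⊎ FormTwo m k n
perfect⇒formOne⊎formTwo m k k-odd n (n>1 , perfect)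
  with primePowerDecomposition n {{>-nonZero (<-trans z<s n>1)}}
... | zero , _ , _ , _ , _ , refl = contradiction n>1 (<-irrefl refl)
... | suc t , p , e , distinct , e>0 , refl = exponent-equation⇒formOne⊎formTwo k-odd p e distinct e>0
  (trans (Equivalence.to (T∘T*≡^⇔ p e distinct e>0 (2 ^ m * k)) perfect) (2^m*k+2^m*k≡pow2*k m k))

theorem3p10 : (k m : ℕ) → ¬ (2 ∣ k) → 0 < k → 0 < m →
    ((p : ℕ) → Prime p → IsKT0TStarPerfect (2 ^ m * k) (p ^ (pow2 m * k ∸ 1)))
    × ((d : Fin (suc (suc m)) → ℕ) → AdmissibleD m k d →
        (p : Fin (suc (suc m)) → ℕ) → DistinctPrimes p →
        IsKT0TStarPerfect (2 ^ m * k) (ProductForm m d p))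
    × ((n : ℕ) → 1 < n → ¬ FormOne m k n → ¬ FormTwo m k n →
        ¬ IsKT0TStarPerfect (2 ^ m * k) n)
theorem3p10 k m k-odd k>0 _ =
  formOne⇒perfect m k k>0 ,
  formTwo⇒perfect m k ,
  λ n _ ¬formOne ¬formTwo perfect →
    [ ¬formOne , ¬formTwo ]′ (perfect⇒formOne⊎formTwo m k k-odd n perfect)
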